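{- Let $(V,\mathcal{E})$ be a finite $3$-uniform hypergraph with at least two vertices in which no four vertices induce exactly one or exactly three hyperedges. Then $(V,\mathcal{E})$ has the De Bruijn–Erdős property: either it has at least $|V|$ distinct lines, or one of its lines equals $V$.
   Context: A $3$-uniform hypergraph $(V,\mathcal{E})$ has all hyperedges of size three. For distinct vertices $u,v$, the line $\overline{uv}$ is the set consisting of $u$, $v$, and all $w$ with $\{u,v,w\}\in\mathcal{E}$. Four distinct vertices induce $k$ hyperedges if exactly $k$ of the hyperedges are subsets of those four vertices. -}

module Defs where

open import Data.Nat using (ℕ; _+_; _≤_)
open import Data.Bool using (Bool; true; false; _∨_; if_then_else_)
open import Data.Fin using (Fin; _≟_)
open import Data.Fin.Subset using (Subset; ⊤)
open import Data.Vec using (tabulate)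
open import Data.Product using (Σ; _×_; _,_; proj₁; proj₂; ∃)
open import Relation.Binary.PropositionalEquality using (_≡_; _≢_)
open import Relation.Nullary using (¬_)
open import Relation.Nullary.Decidable using (⌊_⌋)
open import Function.Definitions using (Injective)

-- The predicate is required to be invariant under permuting its arguments,
-- so it describes a set of 3-element subsets; its values on triples with
-- repeated vertices are irrelevant (never consulted).
record Hypergraph3 (n : ℕ) : Set where
  field
    edge    : Fin n → Fin n → Fin n → Bool
    sym₁₂   : ∀ u v w → edge u v w ≡ edge v u w
    sym₂₃   : ∀ u v w → edge u v w ≡ edge u w v
open Hypergraph3 public

ind : Bool → ℕ
ind b = if b then 1 else 0

induced : ∀ {n} → Hypergraph3 n → Fin n → Fin n → Fin n → Fin n → ℕ
induced H a b c d =
  ind (edge H a b c) + ind (edge H a b d) + ind (edge H a c d) + ind (edge H b c d)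

Distinct4 : ∀ {n} → Fin n → Fin n → Fin n → Fin n → Set
Distinct4 a b c d = a ≢ b × a ≢ c × a ≢ d × b ≢ c × b ≢ d × c ≢ d

No1or3 : ∀ {n} → Hypergraph3 n → Set
No1or3 {n} H = ∀ (a b c d : Fin n) → Distinct4 a b c d →
  ¬ (induced H a b c d ≡ 1) × ¬ (induced H a b c d ≡ 3)

line : ∀ {n} → Hypergraph3 n → Fin n → Fin n → Subset n
line H u v = tabulate λ w → ⌊ w ≟ u ⌋ ∨ ⌊ w ≟ v ⌋ ∨ edge H u v w

Pair : ℕ → Set
Pair n = Σ (Fin n × Fin n) λ p → proj₁ p ≢ proj₂ p

lineOf : ∀ {n} → Hypergraph3 n → Pair n → Subset n
lineOf H ((u , v) , _) = line H u v

AtLeastNLines : ∀ {n} → Hypergraph3 n → Set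
AtLeastNLines {n} H = Σ (Fin n → Pair n) λ f → Injective _≡_ _≡_ (λ i → lineOf H (f i))

HasUniversalLine : ∀ {n} → Hypergraph3 n → Set
HasUniversalLine {n} H = Σ (Pair n) λ p → lineOf H p ≡ ⊤

-- Fix a vertex x. If every triple through x is a hyperedge, every line through x
-- is V. If two lines xi and xj coincide, then {x,i,j} ∈ E and, for each further
-- vertex w, the triples {x,i,w} and {x,j,w} have the same status, so x,i,j,w
-- induce 1 + 2b + [{i,j,w} ∈ E] hyperedges; excluding 1 and 3 forces {i,j,w} ∈ E,
-- i.e. the line ij is V. Otherwise the n − 1 lines through x are pairwise
-- distinct, and the line uv of a non-hyperedge {x,u,v} misses x: an n-th line.
module Submission where

open import Defs
open import Data.Nat using (ℕ; _≤_; suc; s≤s; z≤n; _+_)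
open import Data.Sum using (_⊎_; inj₁; inj₂)
open import Data.Bool using (Bool; true; false; _∨_)
open import Data.Bool.Properties using (∨-zeroʳ; ¬-not) renaming (_≟_ to _≟ᵇ_)
open import Data.Fin using (Fin; zero; suc; _≟_)
open import Data.Fin.Properties using (any?)
open import Data.Fin.Subset using (⊤)
open import Data.Fin.Subset.Properties using (⊆-antisym; ⊆⊤)
open import Data.Vec using (lookup)
open import Data.Vec.Properties using (lookup∘tabulate; lookup⇒[]=; ≡-dec)
open import Data.Product using (_×_; _,_; ∃₂)
open import Relation.Binary.PropositionalEquality
  using (_≡_; _≢_; refl; sym; trans; cong; ≢-sym)
open import Relation.Nullary using (¬_; Dec; yes; no; contradiction)
open import Relation.Nullary.Decidable using (⌊_⌋; ¬?; _×-dec_)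

completes-quadruple : (a b c d : Bool) → a ≡ true → b ≡ c →
  ¬ (ind a + ind b + ind c + ind d ≡ 1) → ¬ (ind a + ind b + ind c + ind d ≡ 3) →
  d ≡ true
completes-quadruple _     _     _      true  _    _    _  _  = refl
completes-quadruple .true false .false false refl refl ≢1 _  = contradiction refl ≢1
completes-quadruple .true true  .true  false refl refl _  ≢3 = contradiction refl ≢3

module _ {n : ℕ} (H : Hypergraph3 n) where

  edge-rotate : ∀ u v w → edge H u v w ≡ edge H w u v
  edge-rotate u v w = trans (sym (sym₂₃ H u w v)) (sym (sym₁₂ H w u v))

  lookup-line : ∀ u v w → lookup (line H u v) w ≡ (⌊ w ≟ u ⌋ ∨ ⌊ w ≟ v ⌋ ∨ edge H u v w)
  lookup-line u v w = lookup∘tabulate _ w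

  lookup-line-left : ∀ u v → lookup (line H u v) u ≡ true
  lookup-line-left u v with u ≟ u | lookup-line u v u
  ... | yes _  | eq = eq
  ... | no u≢u | _  = contradiction refl u≢u

  lookup-line-right : ∀ u v → lookup (line H u v) v ≡ true
  lookup-line-right u v with v ≟ v | lookup-line u v v
  ... | yes _  | eq = trans eq (∨-zeroʳ _)
  ... | no v≢v | _  = contradiction refl v≢v

  lookup-line-outside : ∀ u v w → w ≢ u → w ≢ v → lookup (line H u v) w ≡ edge H u v w
  lookup-line-outside u v w w≢u w≢v with w ≟ u | w ≟ v | lookup-line u v w
  ... | yes w≡u | _       | _  = contradiction w≡u w≢u
  ... | no _    | yes w≡v | _  = contradiction w≡v w≢v
  ... | no _    | no _    | eq = eq

  line≡⊤ : ∀ u v → (∀ w → w ≢ u → w ≢ v → edge H u v w ≡ true) → line H u v ≡ ⊤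
  line≡⊤ u v edges = ⊆-antisym ⊆⊤ (λ {w} _ → lookup⇒[]= w (line H u v) (covers w))
    where
    covers : ∀ w → lookup (line H u v) w ≡ true
    covers w with w ≟ u | w ≟ v
    ... | yes refl | _        = lookup-line-left u v
    ... | no _     | yes refl = lookup-line-right u v
    ... | no w≢u   | no w≢v   = trans (lookup-line-outside u v w w≢u w≢v) (edges w w≢u w≢v)

  NonEdgeThrough : Fin n → Set
  NonEdgeThrough x = ∃₂ λ u v → u ≢ x × v ≢ x × u ≢ v × edge H x u v ≡ false

  nonEdgeThrough? : ∀ x → Dec (NonEdgeThrough x)
  nonEdgeThrough? x = any? λ u → any? λ v →
    ¬? (u ≟ x) ×-dec ¬? (v ≟ x) ×-dec ¬? (u ≟ v) ×-dec (edge H x u v ≟ᵇ false)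

  CoincidingLinesThrough : Fin n → Set
  CoincidingLinesThrough x = ∃₂ λ i j → i ≢ x × j ≢ x × i ≢ j × line H x i ≡ line H x j

  coincidingLinesThrough? : ∀ x → Dec (CoincidingLinesThrough x)
  coincidingLinesThrough? x = any? λ i → any? λ j →
    ¬? (i ≟ x) ×-dec ¬? (j ≟ x) ×-dec ¬? (i ≟ j) ×-dec ≡-dec _≟ᵇ_ (line H x i) (line H x j)

  ¬nonEdgeThrough⇒line≡⊤ : ∀ x y → y ≢ x → ¬ NonEdgeThrough x → line H x y ≡ ⊤
  ¬nonEdgeThrough⇒line≡⊤ x y y≢x full = line≡⊤ x y λ w w≢x w≢y →
    ¬-not λ non-edge → full (y , w , y≢x , w≢x , ≢-sym w≢y , non-edge)

  coinciding-lines⇒line≡⊤ : No1or3 H → ∀ x i j → i ≢ x → j ≢ x → i ≢ j →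
    line H x i ≡ line H x j → line H i j ≡ ⊤
  coinciding-lines⇒line≡⊤ no1or3 x i j i≢x j≢x i≢j xi≡xj = line≡⊤ i j edge-ij
    where
    edge-xij : edge H x i j ≡ true
    edge-xij = trans (sym (lookup-line-outside x i j j≢x (≢-sym i≢j)))
                     (trans (cong (λ ℓ → lookup ℓ j) xi≡xj) (lookup-line-right x j))

    edge-ij : ∀ w → w ≢ i → w ≢ j → edge H i j w ≡ true
    edge-ij w w≢i w≢j with w ≟ x
    ... | yes refl = trans (edge-rotate i j w) edge-xij
    ... | no w≢x   =
      let ≢1 , ≢3 = no1or3 x i j w distinct in completes-quadruple _ _ _ _ edge-xij same-status ≢1 ≢3
      where
      same-status : edge H x i w ≡ edge H x j w
      same-status = trans (sym (lookup-line-outside x i w w≢x w≢i))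
                          (trans (cong (λ ℓ → lookup ℓ w) xi≡xj) (lookup-line-outside x j w w≢x w≢j))
      distinct : Distinct4 x i j w
      distinct = ≢-sym i≢x , ≢-sym j≢x , ≢-sym w≢x , i≢j , ≢-sym w≢i , ≢-sym w≢j

nonEdge∧distinctLines⇒atLeastNLines : ∀ {m} (H : Hypergraph3 (suc m)) →
  NonEdgeThrough H zero → ¬ CoincidingLinesThrough H zero → AtLeastNLines H
nonEdge∧distinctLines⇒atLeastNLines {m} H (u , v , u≢0 , v≢0 , u≢v , non-edge) distinct =
  lines , λ {a} {b} → injective a b
  where
  lines : Fin (suc m) → Pair (suc m)
  lines zero    = (u , v) , u≢v
  lines (suc a) = (zero , suc a) , λ ()

  0∉uv : lookup (line H u v) zero ≡ false
  0∉uv = trans (lookup-line-outside H u v zero (≢-sym u≢0) (≢-sym v≢0))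
               (trans (edge-rotate H u v zero) non-edge)

  injective : ∀ a b → lineOf H (lines a) ≡ lineOf H (lines b) → a ≡ b
  injective zero    zero    _  = refl
  injective zero    (suc b) eq =
    contradiction (trans (sym 0∉uv) (trans (cong (λ ℓ → lookup ℓ zero) eq) (lookup-line-left H zero (suc b))))
                  λ ()
  injective (suc a) zero    eq = sym (injective zero (suc a) (sym eq))
  injective (suc a) (suc b) eq with suc a ≟ suc b
  ... | yes a≡b = a≡b
  ... | no a≢b  = contradiction (suc a , suc b , (λ ()) , (λ ()) , a≢b , eq) distinct

theorem5 : (n : ℕ) → 2 ≤ n → (H : Hypergraph3 n) → No1or3 H →
    AtLeastNLines H ⊎ HasUniversalLine H
theorem5 (suc (suc _)) (s≤s (s≤s z≤n)) H no1or3
  with nonEdgeThrough? H zero | coincidingLinesThrough? H zero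
... | no full | _ =
  inj₂ (((zero , suc zero) , λ ()) , ¬nonEdgeThrough⇒line≡⊤ H zero (suc zero) (λ ()) full)
... | yes _ | yes (i , j , i≢0 , j≢0 , i≢j , 0i≡0j) =
  inj₂ (((i , j) , i≢j) , coinciding-lines⇒line≡⊤ H no1or3 zero i j i≢0 j≢0 i≢j 0i≡0j)
... | yes non-edge | no distinct =
  inj₁ (nonEdge∧distinctLines⇒atLeastNLines H non-edge distinct)
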